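{- Let $1\leq t\leq k-2$ and $2k<n$. Then (i) $h_1(t,k,k+1)>h_1(t,k,k+2)>\cdots>h_1(t,k,2k-t)$; (ii) $\min\{h_1(t,k,2k-t),\ h_1(t,k,n)\}\geq f(n,k,t)$.
   Context: For $X\subseteq M\subseteq C\subseteq[n]$ with $|X|=t$, $|M|=k$, $|C|=c\in\{k+1,\ldots,2k-t,n\}$: $\mathcal{H}_1(X,M,C)=\mathcal{A}\cup\mathcal{B}\cup\mathcal{C}$ where $\mathcal{A}=\{F\in\binom{[n]}{k}: X\subseteq F,\ |F\cap M|\geq t+1\}$, $\mathcal{B}=\{F\in\binom{[n]}{k}: F\cap M=X,\ |F\cap C|=c-k+t\}$, $\mathcal{C}=\{F\in\binom{C}{k}: |F\cap X|=t-1,\ |F\cap M|=k-1\}$; $h_1(t,k,c)=|\mathcal{H}_1(X,M,C)|$ (depends only on $n,t,k,c$). Also $f(n,k,t)=(k-t)\binom{n-t-1}{k-t-1}-\binom{k-t}{2}\binom{n-t-2}{k-t-2}$. -}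

module Defs where

open import Data.Bool using (Bool; true; false; _∧_; _∨_)
open import Data.Nat using (ℕ; zero; suc; _+_; _*_; _∸_; _<ᵇ_; _≡ᵇ_; _≤ᵇ_)
open import Data.Nat.Combinatorics using (_C_)
open import Data.Integer as ℤ using (ℤ; +_)
open import Data.Fin using (Fin; toℕ)
open import Data.Fin.Subset using (Subset; _∩_; _⊆_; ∣_∣)
open import Data.Fin.Subset.Properties using (_⊆?_)
open import Data.Vec using (Vec; []; _∷_; tabulate)
open import Data.Vec.Properties using (≡-dec)
open import Data.List using (List; []; _∷_; _++_; map; filterᵇ; length)
import Data.Bool.Properties as BoolP
open import Relation.Nullary.Decidable using (⌊_⌋)

allSubsets : (n : ℕ) → List (Subset n)
allSubsets zero    = [] ∷ []
allSubsets (suc n) = map (true ∷_) (allSubsets n) ++ map (false ∷_) (allSubsets n)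

seg : (m n : ℕ) → Subset n
seg m n = tabulate (λ i → toℕ i <ᵇ m)

_⊆ᵇ_ : ∀ {n} → Subset n → Subset n → Bool
p ⊆ᵇ q = ⌊ p ⊆? q ⌋

_=ˢ_ : ∀ {n} → Subset n → Subset n → Bool
p =ˢ q = ⌊ ≡-dec BoolP._≟_ p q ⌋

module _ {n : ℕ} (t k : ℕ) (X M C : Subset n) where
  inA : Subset n → Bool
  inA F = (X ⊆ᵇ F) ∧ ((t + 1) ≤ᵇ ∣ F ∩ M ∣)

  inB : Subset n → Bool
  inB F = ((F ∩ M) =ˢ X) ∧ (∣ F ∩ C ∣ ≡ᵇ ((∣ C ∣ ∸ k) + t))

  inC : Subset n → Bool
  inC F = (F ⊆ᵇ C) ∧ ((∣ F ∩ X ∣ ≡ᵇ (t ∸ 1)) ∧ (∣ F ∩ M ∣ ≡ᵇ (k ∸ 1)))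

  inH₁ : Subset n → Bool
  inH₁ F = (∣ F ∣ ≡ᵇ k) ∧ (inA F ∨ (inB F ∨ inC F))

H₁card : (n t k : ℕ) → (X M C : Subset n) → ℕ
H₁card n t k X M C = length (filterᵇ (inH₁ t k X M C) (allSubsets n))

h₁ : (n t k c : ℕ) → ℕ
h₁ n t k c = H₁card n t k (seg t n) (seg k n) (seg c n)

f : (n k t : ℕ) → ℤ
f n k t = (+ ((k ∸ t) * ((n ∸ t ∸ 1) C (k ∸ t ∸ 1))))
          ℤ.- (+ (((k ∸ t) C 2) * ((n ∸ t ∸ 2) C (k ∸ t ∸ 2))))

module Submission where

-- With X = [t], M = [k] and C = [c], every condition defining H₁ is a condition on the
-- traces |F ∩ [j]| of F on initial segments of [n].  Rewriting membership in H₁ as trace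
-- conditions splits H₁ into the disjoint families 𝒜, ℬ, 𝒞, whose sizes are
--   |𝒜| = C(n-t, k-t) - C(n-k, k-t),   |ℬ| = C(n-c, 2k-c-t),   |𝒞| = t(c-k)
-- for k ≤ c ≤ 2k - t (h₁-closed).  Part (i) follows because, by Pascal's rule,
-- h₁(c) - h₁(c+1) = C(n-c-1, 2k-c-t) - t > 0 (h₁-step).  For part (ii), every h₁(c)
-- contains 𝒜, and |𝒜| ≥ f(n,k,t) is the second Bonferroni inequality for the k-sets
-- through X that meet M ∖ X (f≤𝒜).

open import Defs
open import Data.Nat using (ℕ; suc; _+_; _*_; _∸_; _≤_; _<_)
open import Data.Integer as ℤ using (+_; _⊓_)
open import Data.Product using (_×_)

open import Data.Bool using (Bool; true; false; _∧_; _∨_; not; T)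
import Data.Bool.Properties as Boolₚ
open import Data.Empty using (⊥; ⊥-elim)
open import Data.Fin.Subset using (Subset; _∩_; ∣_∣)
open import Data.Fin.Subset.Properties using (_⊆?_)
open import Data.Integer using (_⊖_)
import Data.Integer.Properties as ℤₚ
open import Data.List using (List; []; _∷_; _++_; map; filterᵇ; length)
open import Data.List.Properties using (length-++; filter-++)
open import Data.Nat using (zero; z≤n; s≤s; _≡ᵇ_; _≤ᵇ_)
open import Data.Nat.Combinatorics using (_C_; nCk+nC[k+1]≡[n+1]C[k+1]; k>n⇒nCk≡0)
open import Data.Nat.Properties
open import Data.Nat.Tactic.RingSolver using (solve-∀)
open import Data.Product using (_,_; proj₁; proj₂)
open import Data.Unit using (tt)
open import Data.Vec using ([]; _∷_)
open import Data.Vec.Properties using (≡-dec)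
open import Relation.Binary.PropositionalEquality
open import Relation.Nullary.Decidable using (isYes≗does; does)

⟦_⟧ : Bool → ℕ
⟦ true ⟧  = 1
⟦ false ⟧ = 0

tally : {A : Set} → (A → Bool) → List A → ℕ
tally P xs = length (filterᵇ P xs)

tally-∷ : {A : Set} (P : A → Bool) (x : A) (xs : List A) →
  tally P (x ∷ xs) ≡ ⟦ P x ⟧ + tally P xs
tally-∷ P x xs with P x
... | true  = refl
... | false = refl

tally-++ : {A : Set} (P : A → Bool) (xs ys : List A) →
  tally P (xs ++ ys) ≡ tally P xs + tally P ys
tally-++ P xs ys = trans (cong length (filter-++ _ xs ys)) (length-++ (filterᵇ P xs))

tally-map : {A B : Set} (P : B → Bool) (g : A → B) (xs : List A) →
  tally P (map g xs) ≡ tally (λ x → P (g x)) xs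
tally-map P g []       = refl
tally-map P g (x ∷ xs) = begin
  tally P (g x ∷ map g xs)              ≡⟨ tally-∷ P (g x) (map g xs) ⟩
  ⟦ P (g x) ⟧ + tally P (map g xs)       ≡⟨ cong (_+_ (⟦ P (g x) ⟧)) (tally-map P g xs) ⟩
  ⟦ P (g x) ⟧ + tally (λ y → P (g y)) xs ≡⟨ tally-∷ (λ y → P (g y)) x xs ⟨
  tally (λ y → P (g y)) (x ∷ xs)         ∎
  where open ≡-Reasoning

tally-+ : {A : Set} (P Q R : A → Bool) → (∀ x → ⟦ P x ⟧ ≡ ⟦ Q x ⟧ + ⟦ R x ⟧) →
  ∀ xs → tally P xs ≡ tally Q xs + tally R xs
tally-+ P Q R split []       = refl
tally-+ P Q R split (x ∷ xs) = begin
  tally P (x ∷ xs)                                  ≡⟨ tally-∷ P x xs ⟩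
  ⟦ P x ⟧ + tally P xs                               ≡⟨ cong₂ _+_ (split x) (tally-+ P Q R split xs) ⟩
  (⟦ Q x ⟧ + ⟦ R x ⟧) + (tally Q xs + tally R xs)     ≡⟨ +-assoc ⟦ Q x ⟧ ⟦ R x ⟧ _ ⟩
  ⟦ Q x ⟧ + (⟦ R x ⟧ + (tally Q xs + tally R xs))     ≡⟨ cong (_+_ (⟦ Q x ⟧)) (x+[y+z]≡y+[x+z] ⟦ R x ⟧ (tally Q xs) _) ⟩
  ⟦ Q x ⟧ + (tally Q xs + (⟦ R x ⟧ + tally R xs))     ≡⟨ +-assoc ⟦ Q x ⟧ (tally Q xs) _ ⟨
  (⟦ Q x ⟧ + tally Q xs) + (⟦ R x ⟧ + tally R xs)     ≡⟨ cong₂ _+_ (tally-∷ Q x xs) (tally-∷ R x xs) ⟨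
  tally Q (x ∷ xs) + tally R (x ∷ xs)               ∎
  where
  open ≡-Reasoning
  x+[y+z]≡y+[x+z] : ∀ x y z → x + (y + z) ≡ y + (x + z)
  x+[y+z]≡y+[x+z] = solve-∀

tally-ext : {A : Set} (P Q : A → Bool) → (∀ x → P x ≡ Q x) → ∀ xs → tally P xs ≡ tally Q xs
tally-ext P Q P≗Q []       = refl
tally-ext P Q P≗Q (x ∷ xs) = begin
  tally P (x ∷ xs)      ≡⟨ tally-∷ P x xs ⟩
  ⟦ P x ⟧ + tally P xs   ≡⟨ cong₂ _+_ (cong ⟦_⟧ (P≗Q x)) (tally-ext P Q P≗Q xs) ⟩
  ⟦ Q x ⟧ + tally Q xs   ≡⟨ tally-∷ Q x xs ⟨
  tally Q (x ∷ xs)      ∎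
  where open ≡-Reasoning

tally-none : {A : Set} (P : A → Bool) → (∀ x → P x ≡ false) → ∀ xs → tally P xs ≡ 0
tally-none P never []       = refl
tally-none P never (x ∷ xs) rewrite tally-∷ P x xs | never x = tally-none P never xs

count : (n : ℕ) → (Subset n → Bool) → ℕ
count n P = tally P (allSubsets n)

count-suc : ∀ n (P : Subset (suc n) → Bool) →
  count (suc n) P ≡ count n (λ F → P (true ∷ F)) + count n (λ F → P (false ∷ F))
count-suc n P = trans (tally-++ P (map (true ∷_) (allSubsets n)) (map (false ∷_) (allSubsets n)))
  (cong₂ _+_ (tally-map P (true ∷_) (allSubsets n)) (tally-map P (false ∷_) (allSubsets n)))

count-ext : ∀ n (P Q : Subset n → Bool) → (∀ F → P F ≡ Q F) → count n P ≡ count n Q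
count-ext n P Q P≗Q = tally-ext P Q P≗Q (allSubsets n)

count-none : ∀ n (P : Subset n → Bool) → (∀ F → P F ≡ false) → count n P ≡ 0
count-none n P never = tally-none P never (allSubsets n)

count-∨ : ∀ n (P Q : Subset n → Bool) → (∀ F → P F ∧ Q F ≡ false) →
  count n (λ F → P F ∨ Q F) ≡ count n P + count n Q
count-∨ n P Q disjoint = tally-+ _ P Q (λ F → indicator-∨ (P F) (Q F) (disjoint F)) (allSubsets n)
  where
  indicator-∨ : ∀ p q → p ∧ q ≡ false → ⟦ p ∨ q ⟧ ≡ ⟦ p ⟧ + ⟦ q ⟧
  indicator-∨ true  true  ()
  indicator-∨ true  false _ = refl
  indicator-∨ false q     _ = refl

count-split : ∀ n (P Q : Subset n → Bool) →
  count n P ≡ count n (λ F → P F ∧ not (Q F)) + count n (λ F → P F ∧ Q F)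
count-split n P Q = tally-+ P _ _ (λ F → indicator-split (P F) (Q F)) (allSubsets n)
  where
  indicator-split : ∀ p q → ⟦ p ⟧ ≡ ⟦ p ∧ not q ⟧ + ⟦ p ∧ q ⟧
  indicator-split true  true  = refl
  indicator-split true  false = refl
  indicator-split false q     = refl

bin : ℕ → ℕ → ℕ
bin _       zero    = 1
bin zero    (suc k) = 0
bin (suc n) (suc k) = bin n k + bin n (suc k)

bin≡C : ∀ n k → bin n k ≡ n C k
bin≡C n       zero    = refl
bin≡C zero    (suc k) = sym (k>n⇒nCk≡0 {n = 0} {k = suc k} (s≤s z≤n))
bin≡C (suc n) (suc k) = trans (cong₂ _+_ (bin≡C n k) (bin≡C n (suc k))) (nCk+nC[k+1]≡[n+1]C[k+1] n k)

bin-> : ∀ n k → n < k → bin n k ≡ 0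
bin-> zero    (suc k) _         = refl
bin-> (suc n) (suc k) (s≤s n<k) = cong₂ _+_ (bin-> n k n<k) (bin-> n (suc k) (m≤n⇒m≤1+n n<k))

bin-nn : ∀ n → bin n n ≡ 1
bin-nn zero    = refl
bin-nn (suc n) = cong₂ _+_ (bin-nn n) (bin-> n (suc n) ≤-refl)

bin-n1 : ∀ n → bin n 1 ≡ n
bin-n1 zero    = refl
bin-n1 (suc n) = cong suc (bin-n1 n)

bin-sn : ∀ n → bin (suc n) n ≡ suc n
bin-sn zero    = refl
bin-sn (suc n) = trans (cong₂ _+_ (bin-sn n) (bin-nn (suc n))) (+-comm (suc n) 1)

count-size : ∀ n s → count n (λ F → ∣ F ∣ ≡ᵇ s) ≡ bin n s
count-size zero    zero    = refl
count-size zero    (suc s) = refl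
count-size (suc n) zero    =
  trans (count-suc n _) (trans (cong (_+ count n (λ F → ∣ F ∣ ≡ᵇ 0)) (count-none n _ (λ _ → refl))) (count-size n zero))
count-size (suc n) (suc s) = trans (count-suc n _) (cong₂ _+_ (count-size n s) (count-size n (suc s)))

-- trace j F = |F ∩ [j]|, the number of points of F among the first j points.
-- Peeling off the first point lowers j by one (definitionally, see fits-true).
trace : ∀ {n} → ℕ → Subset n → ℕ
trace {n} j F = ∣ F ∩ seg j n ∣

trace-0 : ∀ {n} (F : Subset n) → trace 0 F ≡ 0
trace-0 []          = refl
trace-0 (true ∷ F)  = trace-0 F
trace-0 (false ∷ F) = trace-0 F

trace-≤ : ∀ {n} j (F : Subset n) → trace j F ≤ j
trace-≤ j       []          = z≤n
trace-≤ zero    F           = ≤-reflexive (trace-0 F)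
trace-≤ (suc j) (true ∷ F)  = s≤s (trace-≤ j F)
trace-≤ (suc j) (false ∷ F) = m≤n⇒m≤1+n (trace-≤ j F)

trace-≤-size : ∀ {n} j (F : Subset n) → trace j F ≤ ∣ F ∣
trace-≤-size j       []          = z≤n
trace-≤-size zero    (true ∷ F)  = m≤n⇒m≤1+n (trace-≤-size zero F)
trace-≤-size zero    (false ∷ F) = trace-≤-size zero F
trace-≤-size (suc j) (true ∷ F)  = s≤s (trace-≤-size j F)
trace-≤-size (suc j) (false ∷ F) = trace-≤-size j F

trace-mono : ∀ {n} {i j} (F : Subset n) → i ≤ j → trace i F ≤ trace j F
trace-mono F           z≤n       = ≤-trans (≤-reflexive (trace-0 F)) z≤n
trace-mono []          (s≤s i≤j) = z≤n
trace-mono (true ∷ F)  (s≤s i≤j) = s≤s (trace-mono F i≤j)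
trace-mono (false ∷ F) (s≤s i≤j) = trace-mono F i≤j

seg-size : ∀ c n → c ≤ n → ∣ seg c n ∣ ≡ c
seg-size zero    zero    _         = refl
seg-size zero    (suc n) _         = seg-size zero n z≤n
seg-size (suc c) (suc n) (s≤s c≤n) = cong suc (seg-size c n c≤n)

-- A block (ℓ , d) asks that the next ℓ points of the ground set contain exactly d points of F.
-- fits o a bs r F: given that the first o points contain a points of F, the blocks bs follow
-- consecutively, and the points after them contain r further points of F.
fits : ∀ {n} → ℕ → ℕ → List (ℕ × ℕ) → ℕ → Subset n → Bool
fits o a []             r F = ∣ F ∣ ≡ᵇ a + r
fits o a ((ℓ , d) ∷ bs) r F = (trace (o + ℓ) F ≡ᵇ a + d) ∧ fits (o + ℓ) (a + d) bs r F

span : List (ℕ × ℕ) → ℕ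
span []             = 0
span ((ℓ , _) ∷ bs) = ℓ + span bs

ways : List (ℕ × ℕ) → ℕ → ℕ → ℕ
ways []             R r = bin R r
ways ((ℓ , d) ∷ bs) R r = bin ℓ d * ways bs R r

fits-true : ∀ {n} o a bs r (F : Subset n) → fits (suc o) (suc a) bs r (true ∷ F) ≡ fits o a bs r F
fits-true o a []             r F = refl
fits-true o a ((ℓ , d) ∷ bs) r F = cong ((trace (o + ℓ) F ≡ᵇ a + d) ∧_) (fits-true (o + ℓ) (a + d) bs r F)

fits-false : ∀ {n} o a bs r (F : Subset n) → fits (suc o) a bs r (false ∷ F) ≡ fits o a bs r F
fits-false o a []             r F = refl
fits-false o a ((ℓ , d) ∷ bs) r F = cong ((trace (o + ℓ) F ≡ᵇ a + d) ∧_) (fits-false (o + ℓ) (a + d) bs r F)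

mutual
  count-fits : ∀ bs R r → count (span bs + R) (fits 0 0 bs r) ≡ ways bs R r
  count-fits []             R r = count-size R r
  count-fits ((ℓ , d) ∷ bs) R r = count-first-block ℓ d bs R r

  count-first-block : ∀ ℓ d bs R r →
    count (ℓ + span bs + R) (fits 0 0 ((ℓ , d) ∷ bs) r) ≡ bin ℓ d * ways bs R r
  count-first-block zero zero bs R r = begin
    count (span bs + R) (fits 0 0 ((0 , 0) ∷ bs) r) ≡⟨ count-ext (span bs + R) _ (fits 0 0 bs r) empty-block ⟩
    count (span bs + R) (fits 0 0 bs r)             ≡⟨ count-fits bs R r ⟩
    ways bs R r                                     ≡⟨ *-identityˡ (ways bs R r) ⟨
    1 * ways bs R r                                 ∎
    where
    open ≡-Reasoning
    empty-block : ∀ F → fits 0 0 ((0 , 0) ∷ bs) r F ≡ fits 0 0 bs r F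
    empty-block F = cong (λ z → (z ≡ᵇ 0) ∧ fits 0 0 bs r F) (trace-0 F)
  count-first-block zero (suc d) bs R r = count-none (span bs + R) _ overfull
    where
    overfull : ∀ F → fits 0 0 ((0 , suc d) ∷ bs) r F ≡ false
    overfull F = cong (λ z → (z ≡ᵇ suc d) ∧ fits 0 (suc d) bs r F) (trace-0 F)
  count-first-block (suc ℓ) d bs R r = trans (count-suc m _) (pascal d)
    where
    m = ℓ + span bs + R
    first-out : ∀ d → count m (λ F → fits 0 0 ((suc ℓ , d) ∷ bs) r (false ∷ F)) ≡ bin ℓ d * ways bs R r
    first-out d = trans (count-ext m _ (fits 0 0 ((ℓ , d) ∷ bs) r)
                          (λ F → cong ((trace ℓ F ≡ᵇ d) ∧_) (fits-false ℓ d bs r F)))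
                        (count-first-block ℓ d bs R r)
    first-in : ∀ d → count m (λ F → fits 0 0 ((suc ℓ , suc d) ∷ bs) r (true ∷ F)) ≡ bin ℓ d * ways bs R r
    first-in d = trans (count-ext m _ (fits 0 0 ((ℓ , d) ∷ bs) r)
                         (λ F → cong ((trace ℓ F ≡ᵇ d) ∧_) (fits-true ℓ d bs r F)))
                       (count-first-block ℓ d bs R r)
    pascal : ∀ d → count m (λ F → fits 0 0 ((suc ℓ , d) ∷ bs) r (true ∷ F))
                   + count m (λ F → fits 0 0 ((suc ℓ , d) ∷ bs) r (false ∷ F))
                   ≡ bin (suc ℓ) d * ways bs R r
    pascal zero    = trans (cong (_+ count m (λ F → fits 0 0 ((suc ℓ , 0) ∷ bs) r (false ∷ F))) (count-none m _ (λ _ → refl)))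
                           (first-out zero)
    pascal (suc d) = trans (cong₂ _+_ (first-in d) (first-out (suc d)))
                           (sym (*-distribʳ-+ (ways bs R r) (bin ℓ d) (bin ℓ (suc d))))

meets : ∀ {n} → List (ℕ × ℕ) → ℕ → Subset n → Bool
meets []             s F = ∣ F ∣ ≡ᵇ s
meets ((j , a) ∷ cs) s F = (trace j F ≡ᵇ a) ∧ meets cs s F

data Chain (n s : ℕ) : ℕ → ℕ → List (ℕ × ℕ) → Set where
  stop : ∀ {o a} → o ≤ n → a ≤ s → Chain n s o a []
  next : ∀ {o a j b cs} → o ≤ j → a ≤ b → Chain n s j b cs → Chain n s o a ((j , b) ∷ cs)

gaps : ℕ → ℕ → List (ℕ × ℕ) → List (ℕ × ℕ)
gaps o a []             = []
gaps o a ((j , b) ∷ cs) = (j ∸ o , b ∸ a) ∷ gaps j b cs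

final : ℕ × ℕ → List (ℕ × ℕ) → ℕ × ℕ
final p []       = p
final p (q ∷ cs) = final q cs

gaps-span : ∀ {n s o a cs} → Chain n s o a cs →
  o + (span (gaps o a cs) + (n ∸ proj₁ (final (o , a) cs))) ≡ n
gaps-span (stop o≤n _) = m+[n∸m]≡n o≤n
gaps-span {n} {o = o} {cs = (j , b) ∷ cs} (next o≤j _ chain) = begin
  o + (((j ∸ o) + S) + R)  ≡⟨ cong (_+_ o) (+-assoc (j ∸ o) S R) ⟩
  o + ((j ∸ o) + (S + R))  ≡⟨ +-assoc o (j ∸ o) (S + R) ⟨
  (o + (j ∸ o)) + (S + R)  ≡⟨ cong (_+ (S + R)) (m+[n∸m]≡n o≤j) ⟩
  j + (S + R)              ≡⟨ gaps-span chain ⟩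
  n                        ∎
  where
  open ≡-Reasoning
  S = span (gaps j b cs)
  R = n ∸ proj₁ (final (j , b) cs)

gaps-fits : ∀ {n s o a cs} → Chain n s o a cs → ∀ (F : Subset n) →
  fits o a (gaps o a cs) (s ∸ proj₂ (final (o , a) cs)) F ≡ meets cs s F
gaps-fits (stop _ a≤s) F = cong (∣ F ∣ ≡ᵇ_) (m+[n∸m]≡n a≤s)
gaps-fits (next o≤j a≤b chain) F
  rewrite m+[n∸m]≡n o≤j | m+[n∸m]≡n a≤b = cong (_ ∧_) (gaps-fits chain F)

count-meets : ∀ {n s cs} → Chain n s 0 0 cs →
  count n (meets cs s) ≡ ways (gaps 0 0 cs) (n ∸ proj₁ (final (0 , 0) cs)) (s ∸ proj₂ (final (0 , 0) cs))
count-meets {n} {s} {cs} chain = trans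
  (count-ext n _ _ (λ F → sym (gaps-fits chain F)))
  (subst (λ m → count m (fits 0 0 (gaps 0 0 cs) r) ≡ ways (gaps 0 0 cs) R r)
         (gaps-span chain) (count-fits (gaps 0 0 cs) R r))
  where
  R = n ∸ proj₁ (final (0 , 0) cs)
  r = s ∸ proj₂ (final (0 , 0) cs)

false-if-¬T : ∀ {b} → (T b → ⊥) → b ≡ false
false-if-¬T {false} _  = refl
false-if-¬T {true}  ¬b = ⊥-elim (¬b tt)

<⇒≡ᵇ-false : ∀ {x y} → x < y → (x ≡ᵇ y) ≡ false
<⇒≡ᵇ-false {x} {y} x<y = false-if-¬T (λ x≡y → <-irrefl (≡ᵇ⇒≡ x y x≡y) x<y)

⊆ᵇ-out : ∀ {n} b (p q : Subset n) → (false ∷ p) ⊆ᵇ (b ∷ q) ≡ p ⊆ᵇ q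
⊆ᵇ-out b p q = trans (isYes≗does ((false ∷ p) ⊆? (b ∷ q))) (sym (isYes≗does (p ⊆? q)))

⊆ᵇ-in : ∀ {n} (p q : Subset n) → (true ∷ p) ⊆ᵇ (true ∷ q) ≡ p ⊆ᵇ q
⊆ᵇ-in p q = trans (isYes≗does ((true ∷ p) ⊆? (true ∷ q))) (sym (isYes≗does (p ⊆? q)))

⊆ᵇ-in-out : ∀ {n} (p q : Subset n) → (true ∷ p) ⊆ᵇ (false ∷ q) ≡ false
⊆ᵇ-in-out p q = isYes≗does ((true ∷ p) ⊆? (false ∷ q))

=ˢ-∷ : ∀ {n} b c (p q : Subset n) → (b ∷ p) =ˢ (c ∷ q) ≡ does (b Boolₚ.≟ c) ∧ (p =ˢ q)
=ˢ-∷ b c p q = trans (isYes≗does (≡-dec Boolₚ._≟_ (b ∷ p) (c ∷ q)))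
                     (cong (does (b Boolₚ.≟ c) ∧_) (sym (isYes≗does (≡-dec Boolₚ._≟_ p q))))

seg⊆ᵇ : ∀ {n} t (F : Subset n) → t ≤ n → (seg t n ⊆ᵇ F) ≡ (trace t F ≡ᵇ t)
seg⊆ᵇ zero    []          _         = refl
seg⊆ᵇ zero    (b ∷ F)     _         = trans (⊆ᵇ-out b _ F) (trans (seg⊆ᵇ zero F z≤n) (sym (trace-0-cons b)))
  where
  trace-0-cons : ∀ b → (trace 0 (b ∷ F) ≡ᵇ 0) ≡ (trace 0 F ≡ᵇ 0)
  trace-0-cons true  = refl
  trace-0-cons false = refl
seg⊆ᵇ {suc n} (suc t) (true ∷ F)  (s≤s t≤n) = trans (⊆ᵇ-in (seg t n) F) (seg⊆ᵇ t F t≤n)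
seg⊆ᵇ {suc n} (suc t) (false ∷ F) (s≤s t≤n) = trans (⊆ᵇ-in-out (seg t n) F) (sym (<⇒≡ᵇ-false (s≤s (trace-≤ t F))))

⊆ᵇseg : ∀ {n} c (F : Subset n) → c ≤ n → (F ⊆ᵇ seg c n) ≡ (trace c F ≡ᵇ ∣ F ∣)
⊆ᵇseg zero    []          _         = refl
⊆ᵇseg {suc n} zero (true ∷ F) _       = trans (⊆ᵇ-in-out F (seg 0 n)) (sym (<⇒≡ᵇ-false (s≤s (trace-≤-size zero F))))
⊆ᵇseg zero    (false ∷ F) _         = trans (⊆ᵇ-out false F _) (⊆ᵇseg zero F z≤n)
⊆ᵇseg (suc c) (true ∷ F)  (s≤s c≤n) = trans (⊆ᵇ-in F _) (⊆ᵇseg c F c≤n)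
⊆ᵇseg (suc c) (false ∷ F) (s≤s c≤n) = trans (⊆ᵇ-out true F _) (⊆ᵇseg c F c≤n)

∩seg=ˢseg : ∀ {n} t k (F : Subset n) → t ≤ k → k ≤ n →
  ((F ∩ seg k n) =ˢ seg t n) ≡ (trace t F ≡ᵇ t) ∧ (trace k F ≡ᵇ t)
∩seg=ˢseg zero    zero    []          _         _         = refl
∩seg=ˢseg zero    zero    (true ∷ F)  _         _         = trans (=ˢ-∷ false false _ _) (∩seg=ˢseg 0 0 F z≤n z≤n)
∩seg=ˢseg zero    zero    (false ∷ F) _         _         = trans (=ˢ-∷ false false _ _) (∩seg=ˢseg 0 0 F z≤n z≤n)
∩seg=ˢseg zero    (suc k) (true ∷ F)  _         _         = sym (Boolₚ.∧-zeroʳ (trace 0 F ≡ᵇ 0))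
∩seg=ˢseg zero    (suc k) (false ∷ F) _         (s≤s k≤n) = trans (=ˢ-∷ false false _ _) (∩seg=ˢseg 0 k F z≤n k≤n)
∩seg=ˢseg (suc t) (suc k) (true ∷ F)  (s≤s t≤k) (s≤s k≤n) = trans (=ˢ-∷ true true _ _) (∩seg=ˢseg t k F t≤k k≤n)
∩seg=ˢseg {suc n} (suc t) (suc k) (false ∷ F) (s≤s t≤k) (s≤s k≤n) = trans (=ˢ-∷ false true (F ∩ seg k n) (seg t n))
  (sym (cong (_∧ (trace k F ≡ᵇ suc t)) (<⇒≡ᵇ-false (s≤s (trace-≤ t F)))))

-- The three families of H₁(X,M,C) for X = [t], M = [k], C = [c], as trace conditions:
-- 𝒜: X ⊆ F and |F ∩ M| ≠ t;  ℬ: F ∩ M = X and |F ∩ C| = c - k + t;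
-- 𝒞: F ⊆ C, |F ∩ X| = t - 1 and |F ∩ M| = k - 1;  all with |F| = k.
𝒜 : ∀ {n} → ℕ → ℕ → Subset n → Bool
𝒜 t k F = meets ((t , t) ∷ []) k F ∧ not (trace k F ≡ᵇ t)

ℬ : ∀ {n} → ℕ → ℕ → ℕ → Subset n → Bool
ℬ t k c = meets ((t , t) ∷ (k , t) ∷ (c , (c ∸ k) + t) ∷ []) k

𝒞 : ∀ {n} → ℕ → ℕ → ℕ → Subset n → Bool
𝒞 t k c = meets ((t , t ∸ 1) ∷ (k , k ∸ 1) ∷ (c , k) ∷ []) k

-- Given X ⊆ F, the condition |F ∩ M| ≥ t + 1 of 𝒜 says |F ∩ M| ≠ t.
≤ᵇ-as-≢ : ∀ {t x m} → x ≤ m → (x ≡ᵇ t) ∧ (t + 1 ≤ᵇ m) ≡ (x ≡ᵇ t) ∧ not (m ≡ᵇ t)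
≤ᵇ-as-≢ {t} {x} {m} x≤m with x ≡ᵇ t in x≡t
... | false = refl
... | true with m ≡ᵇ t in m≡t
...   | true  = false-if-¬T (λ t+1≤m → <-irrefl refl
                  (≤-trans (≤-reflexive (+-comm 1 t)) (≤-trans (≤ᵇ⇒≤ (t + 1) m t+1≤m)
                    (≤-reflexive (≡ᵇ⇒≡ m t (subst T (sym m≡t) tt))))))
...   | false = T⇒≡true (≤⇒≤ᵇ (≤-trans (≤-reflexive (+-comm t 1)) t<m))
  where
  T⇒≡true : ∀ {b} → T b → b ≡ true
  T⇒≡true {true} _ = refl
  t≤m : t ≤ m
  t≤m = subst (_≤ m) (≡ᵇ⇒≡ x t (subst T (sym x≡t) tt)) x≤m
  t<m : t < m
  t<m = ≤∧≢⇒< t≤m (λ t≡m → subst T m≡t (≡⇒≡ᵇ m t (sym t≡m)))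

inH₁-families : ∀ {n} t k c (F : Subset n) → t ≤ k → k ≤ c → c ≤ n →
  inH₁ t k (seg t n) (seg k n) (seg c n) F ≡ 𝒜 t k F ∨ (ℬ t k c F ∨ 𝒞 t k c F)
inH₁-families {n} t k c F t≤k k≤c c≤n
  rewrite seg⊆ᵇ t F (≤-trans t≤k (≤-trans k≤c c≤n)) | ∩seg=ˢseg t k F t≤k (≤-trans k≤c c≤n) | ⊆ᵇseg c F c≤n | seg-size c n c≤n =
  trans (Boolₚ.∧-distribˡ-∨ K _ _)
    (cong₂ _∨_ in-𝒜 (trans (Boolₚ.∧-distribˡ-∨ K _ _) (cong₂ _∨_ in-ℬ in-𝒞)))
  where
  K Xt Mt Mk : Bool
  K  = ∣ F ∣ ≡ᵇ k
  Xt = trace t F ≡ᵇ t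
  Mt = trace k F ≡ᵇ t
  Mk = trace k F ≡ᵇ k ∸ 1
  in-𝒜 : K ∧ (Xt ∧ (t + 1 ≤ᵇ trace k F)) ≡ 𝒜 t k F
  in-𝒜 = begin
    K ∧ (Xt ∧ (t + 1 ≤ᵇ trace k F)) ≡⟨ cong (K ∧_) (≤ᵇ-as-≢ (trace-mono F t≤k)) ⟩
    K ∧ (Xt ∧ not Mt)               ≡⟨ Boolₚ.∧-assoc K Xt (not Mt) ⟨
    (K ∧ Xt) ∧ not Mt               ≡⟨ cong (_∧ not Mt) (Boolₚ.∧-comm K Xt) ⟩
    (Xt ∧ K) ∧ not Mt               ∎
    where open ≡-Reasoning
  in-ℬ : K ∧ ((Xt ∧ Mt) ∧ (trace c F ≡ᵇ (c ∸ k) + t)) ≡ ℬ t k c F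
  in-ℬ = begin
    K ∧ ((Xt ∧ Mt) ∧ Cc)  ≡⟨ Boolₚ.∧-comm K _ ⟩
    ((Xt ∧ Mt) ∧ Cc) ∧ K  ≡⟨ Boolₚ.∧-assoc (Xt ∧ Mt) Cc K ⟩
    (Xt ∧ Mt) ∧ (Cc ∧ K)  ≡⟨ Boolₚ.∧-assoc Xt Mt (Cc ∧ K) ⟩
    Xt ∧ (Mt ∧ (Cc ∧ K))  ∎
    where
    open ≡-Reasoning
    Cc = trace c F ≡ᵇ (c ∸ k) + t
  in-𝒞 : K ∧ ((trace c F ≡ᵇ ∣ F ∣) ∧ ((trace t F ≡ᵇ t ∸ 1) ∧ Mk)) ≡ 𝒞 t k c F
  in-𝒞 = begin
    K ∧ (Cs ∧ Y)    ≡⟨ Boolₚ.∧-assoc K Cs Y ⟨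
    (K ∧ Cs) ∧ Y    ≡⟨ cong (_∧ Y) (size-known ∣ F ∣ (trace c F)) ⟩
    (K ∧ Ck) ∧ Y    ≡⟨ Boolₚ.∧-comm (K ∧ Ck) Y ⟩
    Y ∧ (K ∧ Ck)    ≡⟨ cong (Y ∧_) (Boolₚ.∧-comm K Ck) ⟩
    Y ∧ (Ck ∧ K)    ≡⟨ Boolₚ.∧-assoc (trace t F ≡ᵇ t ∸ 1) Mk (Ck ∧ K) ⟩
    𝒞 t k c F       ∎
    where
    open ≡-Reasoning
    Cs = trace c F ≡ᵇ ∣ F ∣
    Ck = trace c F ≡ᵇ k
    Y  = (trace t F ≡ᵇ t ∸ 1) ∧ Mk
    size-known : ∀ s x → (s ≡ᵇ k) ∧ (x ≡ᵇ s) ≡ (s ≡ᵇ k) ∧ (x ≡ᵇ k)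
    size-known s x with s ≡ᵇ k in s≡k
    ... | false = refl
    ... | true rewrite ≡ᵇ⇒≡ s k (subst T (sym s≡k) tt) = refl

T-∧ˡ : ∀ {x y} → T (x ∧ y) → T x
T-∧ˡ {true} _ = tt

T-∧ʳ : ∀ {x y} → T (x ∧ y) → T y
T-∧ʳ {true} y = y

exclusive : ∀ {p q} → (T p → T q → ⊥) → p ∧ q ≡ false
exclusive {false}         _     = refl
exclusive {true} {false}  _     = refl
exclusive {true} {true}   clash = ⊥-elim (clash tt tt)

-- For 1 ≤ t ≤ k - 2 the three families are pairwise disjoint, so h₁ is the sum of their sizes.
h₁-families : ∀ n t k c → 1 ≤ t → t + 2 ≤ k → k ≤ c → c ≤ n →
  h₁ n t k c ≡ count n (𝒜 t k) + (count n (ℬ t k c) + count n (𝒞 t k c))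
h₁-families n t k c 1≤t t+2≤k k≤c c≤n =
  trans (count-ext n _ _ (λ F → inH₁-families t k c F t≤k k≤c c≤n))
  (trans (count-∨ n (𝒜 t k) (λ F → ℬ t k c F ∨ 𝒞 t k c F)
            (λ F → trans (Boolₚ.∧-distribˡ-∨ (𝒜 t k F) _ _)
                         (cong₂ _∨_ (exclusive (𝒜∩ℬ F)) (exclusive (𝒜∩𝒞 F)))))
         (cong (_+_ (count n (𝒜 t k))) (count-∨ n (ℬ t k c) (𝒞 t k c) (λ F → exclusive (ℬ∩𝒞 F)))))
  where
  t≤k : t ≤ k
  t≤k = ≤-trans (m≤m+n t 2) t+2≤k
  t<k∸1 : t < k ∸ 1
  t<k∸1 = m+n≤o⇒m≤o∸n (suc t) (subst (_≤ k) (+-suc t 1) t+2≤k)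
  t∸1<t : t ∸ 1 < t
  t∸1<t = ∸-monoʳ-< (s≤s z≤n) 1≤t
  not-both : ∀ {b} → T (not b) → T b → ⊥
  not-both {true} () _
  𝒜∩ℬ : ∀ (F : Subset n) → T (𝒜 t k F) → T (ℬ t k c F) → ⊥
  𝒜∩ℬ F inA inB = not-both (T-∧ʳ {meets ((t , t) ∷ []) k F} inA) (T-∧ˡ (T-∧ʳ {trace t F ≡ᵇ t} inB))
  𝒜∩𝒞 : ∀ (F : Subset n) → T (𝒜 t k F) → T (𝒞 t k c F) → ⊥
  𝒜∩𝒞 F inA inC = <⇒≢ t∸1<t (trans (sym (≡ᵇ⇒≡ (trace t F) (t ∸ 1) (T-∧ˡ inC)))
                                       (≡ᵇ⇒≡ (trace t F) t (T-∧ˡ (T-∧ˡ {meets ((t , t) ∷ []) k F} inA))))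
  ℬ∩𝒞 : ∀ (F : Subset n) → T (ℬ t k c F) → T (𝒞 t k c F) → ⊥
  ℬ∩𝒞 F inB inC = <⇒≢ t<k∸1 (trans (sym (≡ᵇ⇒≡ (trace k F) t (T-∧ˡ (T-∧ʳ {trace t F ≡ᵇ t} inB))))
                                       (≡ᵇ⇒≡ (trace k F) (k ∸ 1) (T-∧ˡ (T-∧ʳ {trace t F ≡ᵇ t ∸ 1} inC))))

bin-diag-* : ∀ m x → bin m m * x ≡ x
bin-diag-* m x = trans (cong (_* x) (bin-nn m)) (*-identityˡ x)

bin-none-* : ∀ m d x → d ≡ 0 → bin m d * x ≡ x
bin-none-* m .0 x refl = *-identityˡ x

-- |𝒞| = t (c - k): choose the missing point of X and the extra point of C ∖ M.
𝒞-size : ∀ n t k c → 1 ≤ t → t ≤ k → k ≤ c → c ≤ n → count n (𝒞 t k c) ≡ t * (c ∸ k)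
𝒞-size n (suc t) (suc k) c _ t≤k k≤c c≤n = begin
  count n (𝒞 (suc t) (suc k) c)
    ≡⟨ count-meets (next z≤n z≤n (next t≤k (≤-pred t≤k) (next k≤c (n≤1+n k) (stop c≤n ≤-refl)))) ⟩
  bin (suc t) t * (bin (k ∸ t) (k ∸ t) * (bin (c ∸ suc k) (suc k ∸ k) * bin (n ∸ c) (k ∸ k)))
    ≡⟨ cong₂ _*_ (bin-sn t) (bin-diag-* (k ∸ t) _) ⟩
  suc t * (bin (c ∸ suc k) (suc k ∸ k) * bin (n ∸ c) (k ∸ k))
    ≡⟨ cong (λ e → suc t * (bin (c ∸ suc k) e * bin (n ∸ c) (k ∸ k))) (m+n∸n≡m 1 k) ⟩
  suc t * (bin (c ∸ suc k) 1 * bin (n ∸ c) (k ∸ k))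
    ≡⟨ cong (suc t *_) (cong₂ _*_ (bin-n1 (c ∸ suc k)) (cong (bin (n ∸ c)) (n∸n≡0 k))) ⟩
  suc t * ((c ∸ suc k) * 1)
    ≡⟨ cong (suc t *_) (*-identityʳ (c ∸ suc k)) ⟩
  suc t * (c ∸ suc k) ∎
  where open ≡-Reasoning

-- |ℬ| = C(n - c, 2k - c - t): F ∩ C is X plus all of C ∖ M, the rest lies outside C.
ℬ-size : ∀ n t k c → t ≤ k → k ≤ c → c ≤ n → (c ∸ k) + t ≤ k →
  count n (ℬ t k c) ≡ bin (n ∸ c) (k ∸ ((c ∸ k) + t))
ℬ-size n t k c t≤k k≤c c≤n fits-in-k = begin
  count n (ℬ t k c)
    ≡⟨ count-meets (next z≤n z≤n (next t≤k ≤-refl (next k≤c (m≤n+m t (c ∸ k)) (stop c≤n fits-in-k)))) ⟩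
  bin t t * (bin (k ∸ t) (t ∸ t) * (bin (c ∸ k) ((c ∸ k) + t ∸ t) * B))
    ≡⟨ bin-diag-* t _ ⟩
  bin (k ∸ t) (t ∸ t) * (bin (c ∸ k) ((c ∸ k) + t ∸ t) * B)
    ≡⟨ bin-none-* (k ∸ t) (t ∸ t) _ (n∸n≡0 t) ⟩
  bin (c ∸ k) ((c ∸ k) + t ∸ t) * B
    ≡⟨ cong (λ e → bin (c ∸ k) e * B) (m+n∸n≡m (c ∸ k) t) ⟩
  bin (c ∸ k) (c ∸ k) * B
    ≡⟨ bin-diag-* (c ∸ k) B ⟩
  B ∎
  where
  open ≡-Reasoning
  B = bin (n ∸ c) (k ∸ ((c ∸ k) + t))

-- |𝒜| = C(n - t, k - t) - C(n - k, k - t): the k-sets through X minus those with F ∩ M = X.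
𝒜-size : ∀ n t k → t ≤ k → k ≤ n → count n (𝒜 t k) + bin (n ∸ k) (k ∸ t) ≡ bin (n ∸ t) (k ∸ t)
𝒜-size n t k t≤k k≤n = begin
  count n (𝒜 t k) + bin (n ∸ k) (k ∸ t)
    ≡⟨ cong (_+_ (count n (𝒜 t k))) (sym exact) ⟩
  count n (𝒜 t k) + count n (λ F → through-X F ∧ (trace k F ≡ᵇ t))
    ≡⟨ count-split n through-X (λ F → trace k F ≡ᵇ t) ⟨
  count n through-X
    ≡⟨ count-meets (next z≤n z≤n (stop t≤n t≤k)) ⟩
  bin t t * bin (n ∸ t) (k ∸ t)
    ≡⟨ bin-diag-* t _ ⟩
  bin (n ∸ t) (k ∸ t) ∎
  where
  open ≡-Reasoning
  t≤n = ≤-trans t≤k k≤n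
  through-X : Subset n → Bool
  through-X = meets ((t , t) ∷ []) k
  exact : count n (λ F → through-X F ∧ (trace k F ≡ᵇ t)) ≡ bin (n ∸ k) (k ∸ t)
  exact = begin
    count n (λ F → through-X F ∧ (trace k F ≡ᵇ t))
      ≡⟨ count-ext n _ (meets ((t , t) ∷ (k , t) ∷ []) k)
           (λ F → trans (Boolₚ.∧-assoc (trace t F ≡ᵇ t) _ _)
                        (cong ((trace t F ≡ᵇ t) ∧_) (Boolₚ.∧-comm (∣ F ∣ ≡ᵇ k) _))) ⟩
    count n (meets ((t , t) ∷ (k , t) ∷ []) k)
      ≡⟨ count-meets (next z≤n z≤n (next t≤k ≤-refl (stop k≤n t≤k))) ⟩
    bin t t * (bin (k ∸ t) (t ∸ t) * bin (n ∸ k) (k ∸ t))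
      ≡⟨ bin-diag-* t _ ⟩
    bin (k ∸ t) (t ∸ t) * bin (n ∸ k) (k ∸ t)
      ≡⟨ bin-none-* (k ∸ t) (t ∸ t) _ (n∸n≡0 t) ⟩
    bin (n ∸ k) (k ∸ t) ∎

bin-step : ∀ a p → bin a p ≤ bin (suc a) p
bin-step a zero    = ≤-refl
bin-step a (suc p) = m≤n+m (bin a (suc p)) (bin a p)

bin-monoˡ : ∀ {a b} p → a ≤ b → bin a p ≤ bin b p
bin-monoˡ {a} {b} p a≤b = subst (λ m → bin a p ≤ bin m p) (m∸n+n≡m a≤b) (grow (b ∸ a))
  where
  grow : ∀ d → bin a p ≤ bin (d + a) p
  grow zero    = ≤-refl
  grow (suc d) = ≤-trans (grow d) (bin-step (d + a) p)

-- An (s+1+E)-set has more than E subsets of size s + 1 (already those containing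
-- its first s points).
bin-large : ∀ s E → suc E ≤ bin (suc s + E) (suc s)
bin-large zero    E = ≤-reflexive (cong suc (sym (bin-n1 E)))
bin-large (suc s) E = ≤-trans (bin-large s E) (m≤m+n _ _)

bin-exceeds : ∀ {S t R} → suc S + t ≤ R → t < bin R (suc S)
bin-exceeds {S} {t} room = ≤-trans (bin-large S t) (bin-monoˡ (suc S) room)

-- Union bound.  Split an (M+1)-set into W points and u further points; a (p+1)-subset
-- either lies among the W points or contains one of the u points and p other points.
union-bound : ∀ p u W M → W + u ≡ suc M → bin (suc M) (suc p) ≤ bin W (suc p) + u * bin M p
union-bound p zero    W M W≡ = ≤-reflexive (trans (cong (λ m → bin m (suc p)) (trans (sym W≡) (+-identityʳ W)))
                                                  (sym (+-identityʳ _)))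
union-bound p (suc u) W M W+u+1≡ = begin
  bin (suc M) (suc p)                          ≤⟨ union-bound p u (suc W) M (trans (sym (+-suc W u)) W+u+1≡) ⟩
  bin (suc W) (suc p) + u * bin M p            ≡⟨ +-assoc (bin W p) (bin W (suc p)) (u * bin M p) ⟩
  bin W p + (bin W (suc p) + u * bin M p)      ≤⟨ +-monoˡ-≤ _ (bin-monoˡ p W≤M) ⟩
  bin M p + (bin W (suc p) + u * bin M p)      ≡⟨ rearrange (bin M p) (bin W (suc p)) u ⟩
  bin W (suc p) + suc u * bin M p              ∎
  where
  open ≤-Reasoning
  W≤M : W ≤ M
  W≤M = ≤-pred (≤-trans (s≤s (m≤m+n W u)) (≤-reflexive (trans (sym (+-suc W u)) W+u+1≡)))
  rearrange : ∀ z b u → z + (b + u * z) ≡ b + suc u * z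
  rearrange = solve-∀

-- Second Bonferroni inequality.  With an (M+2)-set split into W points and a u-set U,
-- the (p+2)-subsets meeting U number at least u C(M+1, p+1) - C(u, 2) C(M, p).
bonferroni : ∀ p u W M → W + u ≡ suc (suc M) →
  u * bin (suc M) (suc p) + bin W (suc (suc p)) ≤ bin (suc (suc M)) (suc (suc p)) + bin u 2 * bin M p
bonferroni p zero W M W≡ =
  ≤-reflexive (trans (cong (λ m → bin m (suc (suc p))) (trans (sym (+-identityʳ W)) W≡)) (sym (+-identityʳ _)))
bonferroni p (suc u) W M W+u+1≡ = begin
  suc u * a + c                ≡⟨ unfold u a c ⟩
  a + (u * a + c)              ≤⟨ +-monoˡ-≤ (u * a + c) (union-bound p u W M W+u≡) ⟩
  (b + u * z) + (u * a + c)    ≡⟨ regroup u a b c z ⟩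
  (u * a + (b + c)) + u * z    ≤⟨ +-monoˡ-≤ (u * z) (bonferroni p u (suc W) M (trans (sym (+-suc W u)) W+u+1≡)) ⟩
  (X + bin u 2 * z) + u * z    ≡⟨ collect X (bin u 2) z u ⟩
  X + (u + bin u 2) * z        ≡⟨ cong (λ v → X + (v + bin u 2) * z) (sym (bin-n1 u)) ⟩
  X + bin (suc u) 2 * z        ∎
  where
  open ≤-Reasoning
  a = bin (suc M) (suc p)
  b = bin W (suc p)
  c = bin W (suc (suc p))
  z = bin M p
  X = bin (suc (suc M)) (suc (suc p))
  W+u≡ : W + u ≡ suc M
  W+u≡ = suc-injective (trans (sym (+-suc W u)) W+u+1≡)
  unfold : ∀ u a c → suc u * a + c ≡ a + (u * a + c)
  unfold = solve-∀
  regroup : ∀ u a b c z → (b + u * z) + (u * a + c) ≡ (u * a + (b + c)) + u * z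
  regroup = solve-∀
  collect : ∀ X y z u → (X + y * z) + u * z ≡ X + (u + y) * z
  collect = solve-∀

difference-≤ : ∀ {a b x} → a ≤ x + b → + a ℤ.- + b ℤ.≤ + x
difference-≤ {a} {b} {x} a≤x+b = begin
  + a ℤ.- + b     ≡⟨ ℤₚ.m-n≡m⊖n a b ⟩
  a ⊖ b           ≤⟨ ℤₚ.⊖-monoˡ-≤ b a≤x+b ⟩
  (x + b) ⊖ b     ≡⟨ ℤₚ.⊖-≥ (m≤n+m b x) ⟩
  + (x + b ∸ b)   ≡⟨ cong +_ (m+n∸n≡m x b) ⟩
  + x             ∎
  where open ℤₚ.≤-Reasoning

h₁-closed : ∀ n t k c D S R → 1 ≤ t → t + 2 ≤ k → k + D ≡ c → D + t + S ≡ k → c + R ≡ n →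
  h₁ n t k c ≡ count n (𝒜 t k) + (bin R S + t * D)
h₁-closed .(k + D + R) t k .(k + D) D S R 1≤t t+2≤k refl k≡ refl = begin
  h₁ n t k c
    ≡⟨ h₁-families n t k c 1≤t t+2≤k (m≤m+n k D) (m≤m+n c R) ⟩
  count n (𝒜 t k) + (count n (ℬ t k c) + count n (𝒞 t k c))
    ≡⟨ cong (_+_ (count n (𝒜 t k))) (cong₂ _+_ (ℬ-size n t k c t≤k (m≤m+n k D) (m≤m+n c R) c∸k+t≤k)
                                                (𝒞-size n t k c 1≤t t≤k (m≤m+n k D) (m≤m+n c R))) ⟩
  count n (𝒜 t k) + (bin (n ∸ c) (k ∸ ((c ∸ k) + t)) + t * (c ∸ k))
    ≡⟨ cong (_+_ (count n (𝒜 t k))) (cong₂ _+_ (cong₂ bin (m+n∸m≡n c R) S≡) (cong (t *_) c∸k≡D)) ⟩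
  count n (𝒜 t k) + (bin R S + t * D) ∎
  where
  open ≡-Reasoning
  c = k + D
  n = c + R
  t≤k = ≤-trans (m≤m+n t 2) t+2≤k
  c∸k≡D : c ∸ k ≡ D
  c∸k≡D = m+n∸m≡n k D
  c∸k+t≤k : (c ∸ k) + t ≤ k
  c∸k+t≤k = subst₂ _≤_ (cong (_+ t) (sym c∸k≡D)) k≡ (m≤m+n (D + t) S)
  S≡ : k ∸ ((c ∸ k) + t) ≡ S
  S≡ = trans (cong (λ d → k ∸ (d + t)) c∸k≡D) (trans (cong (_∸ (D + t)) (sym k≡)) (m+n∸m≡n (D + t) S))

record StepShape (n t k c : ℕ) : Set where
  field
    D S R : ℕ
    c≡ : k + D ≡ c
    k≡ : suc D + t + S ≡ k
    n≡ : suc c + R ≡ n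
    room : suc S + t ≤ R

step-shape : ∀ n t k c → k ≤ c → suc c + t ≤ 2 * k → 2 * k < n → StepShape n t k c
step-shape n t k c k≤c c+1+t≤2k 2k<n = record
  { D = D ; S = S ; R = R ; c≡ = c≡ ; k≡ = k≡ ; n≡ = n≡ ; room = room }
  where
  D = c ∸ k
  c≡ : k + D ≡ c
  c≡ = m+[n∸m]≡n k≤c
  two-k : 2 * k ≡ k + k
  two-k = cong (_+_ k) (+-identityʳ k)
  D+1+t≤k : suc D + t ≤ k
  D+1+t≤k = +-cancelˡ-≤ k _ _ (subst₂ _≤_ (trans (cong (λ x → suc x + t) (sym c≡)) (shift k D t)) two-k c+1+t≤2k)
    where
    shift : ∀ k D t → suc (k + D) + t ≡ k + (suc D + t)
    shift = solve-∀
  S = k ∸ (suc D + t)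
  k≡ : suc D + t + S ≡ k
  k≡ = m+[n∸m]≡n D+1+t≤k
  c+1≤n : suc c ≤ n
  c+1≤n = ≤-trans (m≤m+n (suc c) t) (≤-trans c+1+t≤2k (<⇒≤ 2k<n))
  R = n ∸ suc c
  n≡ : suc c + R ≡ n
  n≡ = m+[n∸m]≡n c+1≤n
  total : suc c + (suc S + t) ≡ suc (2 * k)
  total = begin
    suc c + (suc S + t)          ≡⟨ cong (λ x → suc x + (suc S + t)) (sym c≡) ⟩
    suc (k + D) + (suc S + t)    ≡⟨ regroup k D S t ⟩
    suc (k + (suc D + t + S))    ≡⟨ cong (λ x → suc (k + x)) k≡ ⟩
    suc (k + k)                  ≡⟨ cong suc two-k ⟨
    suc (2 * k)                  ∎
    where
    open ≡-Reasoning
    regroup : ∀ k D S t → suc (k + D) + (suc S + t) ≡ suc (k + (suc D + t + S))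
    regroup = solve-∀
  room : suc S + t ≤ R
  room = +-cancelˡ-≤ (suc c) _ _ (subst₂ _≤_ (sym total) (sym n≡) 2k<n)

-- Part (i): one step of the decreasing sequence.  By the closed form,
-- h₁(c) - h₁(c+1) = C(R+1, S+1) - C(R, S) - t = C(R, S+1) - t > 0.
h₁-step : ∀ n t k c → 1 ≤ t → t + 2 ≤ k → StepShape n t k c → h₁ n t k (suc c) < h₁ n t k c
h₁-step n t k c 1≤t t+2≤k shape = begin-strict
  h₁ n t k (suc c)
    ≡⟨ h₁-closed n t k (suc c) (suc D) S R 1≤t t+2≤k (trans (+-suc k D) (cong suc c≡)) k≡ n≡ ⟩
  A + (bin R S + t * suc D)
    ≡⟨ cong (λ x → A + (bin R S + x)) (*-suc t D) ⟩
  A + (bin R S + (t + t * D))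
    <⟨ +-monoʳ-< A (+-monoʳ-< (bin R S) (+-monoˡ-< (t * D) (bin-exceeds room))) ⟩
  A + (bin R S + (bin R (suc S) + t * D))
    ≡⟨ cong (_+_ A) (+-assoc (bin R S) (bin R (suc S)) (t * D)) ⟨
  A + (bin (suc R) (suc S) + t * D)
    ≡⟨ h₁-closed n t k c D (suc S) (suc R) 1≤t t+2≤k c≡ (trans (+-suc (D + t) S) k≡) (trans (+-suc c R) n≡) ⟨
  h₁ n t k c ∎
  where
  open StepShape shape
  open ≤-Reasoning
  A = count n (𝒜 t k)

𝒜≤h₁ : ∀ n t k c → 1 ≤ t → t + 2 ≤ k → k ≤ c → c ≤ n → count n (𝒜 t k) ≤ h₁ n t k c
𝒜≤h₁ n t k c 1≤t t+2≤k k≤c c≤n =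
  subst (count n (𝒜 t k) ≤_) (sym (h₁-families n t k c 1≤t t+2≤k k≤c c≤n)) (m≤m+n _ _)

-- Part (ii): |𝒜| ≥ f(n,k,t), by the second Bonferroni inequality for the k-sets through X
-- meeting M ∖ X.
f≤𝒜 : ∀ n t k → t + 2 ≤ k → k ≤ n → f n k t ℤ.≤ + count n (𝒜 t k)
f≤𝒜 n t k t+2≤k k≤n with m≤n⇒∃[o]m+o≡n (subst (_≤ k ∸ t) (m+n∸m≡n t 2) (∸-monoˡ-≤ t t+2≤k))
                        | m≤n⇒∃[o]m+o≡n (subst (_≤ n ∸ t) (m+n∸m≡n t 2) (∸-monoˡ-≤ t (≤-trans t+2≤k k≤n)))
... | p , u≡ | M , N≡ = subst (ℤ._≤ + A) (sym f≡) (difference-≤ main)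
  where
  t≤k = ≤-trans (m≤m+n t 2) t+2≤k
  A = count n (𝒜 t k)
  u = k ∸ t
  W = n ∸ k
  f≡ : f n k t ≡ + (u * bin (suc M) (suc p)) ℤ.- + (bin u 2 * bin M p)
  f≡ = cong₂ (λ x y → + (u * x) ℤ.- + y)
         (trans (cong₂ _C_ (cong (_∸ 1) (sym N≡)) (cong (_∸ 1) (sym u≡))) (sym (bin≡C (suc M) (suc p))))
         (trans (cong₂ _*_ (sym (bin≡C u 2))
                  (trans (cong₂ _C_ (cong (_∸ 2) (sym N≡)) (cong (_∸ 2) (sym u≡))) (sym (bin≡C M p))))
                refl)
  W+u≡ : W + u ≡ suc (suc M)
  W+u≡ = trans (trans (sym (+-∸-assoc W t≤k)) (cong (_∸ t) (m∸n+n≡m k≤n))) (sym N≡)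
  𝒜≡ : A + bin W u ≡ bin (suc (suc M)) (suc (suc p))
  𝒜≡ = subst₂ (λ N v → A + bin W u ≡ bin N v) (sym N≡) (sym u≡) (𝒜-size n t k t≤k k≤n)
  main : u * bin (suc M) (suc p) ≤ A + bin u 2 * bin M p
  main = +-cancelʳ-≤ (bin W u) _ _ (begin
    u * bin (suc M) (suc p) + bin W u
      ≡⟨ cong (λ v → v * bin (suc M) (suc p) + bin W v) u≡ ⟨
    suc (suc p) * bin (suc M) (suc p) + bin W (suc (suc p))
      ≤⟨ bonferroni p (suc (suc p)) W M (subst (λ v → W + v ≡ suc (suc M)) (sym u≡) W+u≡) ⟩
    bin (suc (suc M)) (suc (suc p)) + bin (suc (suc p)) 2 * bin M p
      ≡⟨ cong₂ (λ x v → x + bin v 2 * bin M p) 𝒜≡ (sym u≡) ⟨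
    (A + bin W u) + bin u 2 * bin M p
      ≡⟨ swap A (bin W u) (bin u 2 * bin M p) ⟩
    (A + bin u 2 * bin M p) + bin W u ∎)
    where
    open ≤-Reasoning
    swap : ∀ x y z → (x + y) + z ≡ (x + z) + y
    swap = solve-∀

t+2≤k : ∀ {t k} → 1 ≤ t → t ≤ k ∸ 2 → t + 2 ≤ k
t+2≤k {suc t} {suc (suc k)} _ t≤k = subst (_≤ suc (suc k)) (+-comm 2 (suc t)) (s≤s (s≤s t≤k))

lemma2p7 : (n t k : ℕ) → 1 ≤ t → t ≤ k ∸ 2 → 2 * k < n →
    ((c : ℕ) → k + 1 ≤ c → c < 2 * k ∸ t → h₁ n t k (suc c) < h₁ n t k c)
    × (f n k t ℤ.≤ ((+ h₁ n t k (2 * k ∸ t)) ⊓ (+ h₁ n t k n)))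
lemma2p7 n t k 1≤t t≤k∸2 2k<n = decreasing , bounded-below
  where
  t+2≤k′ = t+2≤k 1≤t t≤k∸2
  t≤k = ≤-trans (m≤m+n t 2) t+2≤k′
  k≤2k : k ≤ 2 * k
  k≤2k = m≤m+n k (k + 0)
  k≤n = ≤-trans k≤2k (<⇒≤ 2k<n)
  decreasing : (c : ℕ) → k + 1 ≤ c → c < 2 * k ∸ t → h₁ n t k (suc c) < h₁ n t k c
  decreasing c k+1≤c c<2k∸t = h₁-step n t k c 1≤t t+2≤k′
    (step-shape n t k c (≤-trans (m≤m+n k 1) k+1≤c) (m≤o∸n⇒m+n≤o (suc c) (≤-trans t≤k k≤2k) c<2k∸t) 2k<n)
  above-f : ∀ c → k ≤ c → c ≤ n → f n k t ℤ.≤ + h₁ n t k c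
  above-f c k≤c c≤n = ℤₚ.≤-trans (f≤𝒜 n t k t+2≤k′ k≤n) (ℤ.+≤+ (𝒜≤h₁ n t k c 1≤t t+2≤k′ k≤c c≤n))
  bounded-below : f n k t ℤ.≤ ((+ h₁ n t k (2 * k ∸ t)) ⊓ (+ h₁ n t k n))
  bounded-below = ℤₚ.⊓-glb
    (above-f (2 * k ∸ t) (m+n≤o⇒m≤o∸n k (≤-trans (+-monoʳ-≤ k t≤k) (≤-reflexive (cong (_+_ k) (sym (+-identityʳ k))))))
                         (≤-trans (m∸n≤m (2 * k) t) (<⇒≤ 2k<n)))
    (above-f n k≤n ≤-refl)
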